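{- For every integer $k\ge 3$ with $k\neq 5$, $f(\overrightarrow{C_k}) = \frac{2k}{3}$, and $f(\overrightarrow{C_5}) = \frac{25}{8}$.
   Context: $\overrightarrow{C_k}$ is the directed cycle on $k$ vertices. Directed graphs have no loops or parallel arcs but may contain directed 2-cycles. For a directed graph $L$, the blowup $B(L)$ replaces each vertex $v$ by a countably infinite independent set $I_v$ with all arcs from $I_a$ to $I_b$ whenever $(a,b)\in E(L)$. For a directed graph $H$, ${\rm disc}_H(L)$ is the minimum number of arcs that must be added to $B(L)$ to obtain a copy of $H$. $f(H,L)=\max\{|E(H)|(1-|E(L)|/|V(L)|^2),\,|E(H)|-{\rm disc}_H(L)\}$ and $f(H)=\inf_L f(H,L)$ over all directed graphs $L$ with at least one arc. -}

module Defs where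

open import Data.Bool using (Bool; true; false; if_then_else_)
open import Data.Nat as ℕ using (ℕ; zero; suc; _≡ᵇ_)
open import Data.Fin using (Fin; toℕ)
open import Data.List using (List; map; allFin; length)
open import Data.Nat.ListAction using (sum)
open import Data.List.Membership.Propositional using (_∈_)
open import Data.List.Relation.Unary.Unique.Propositional using (Unique)
open import Data.Integer as ℤ using (ℤ; +_)
open import Data.Rational using (ℚ; _/_; _*_; _-_; _+_; _⊔_; _≤_; _<_; 1ℚ; 0ℚ)
open import Data.Product using (Σ; _×_; _,_; ∃)
open import Data.Sum using (_⊎_)
open import Relation.Binary.PropositionalEquality using (_≡_; _≢_)
open import Function.Definitions using (Injective)

Digraph : ℕ → Set
Digraph n = Fin n → Fin n → Bool

-- Directed graph condition: no loops (directed 2-cycles are allowed;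
-- parallel arcs are impossible since arcs form a relation).
IsDigraph : ∀ {n} → Digraph n → Set
IsDigraph {n} G = ∀ (i : Fin n) → G i i ≡ false

HasArc : ∀ {n} → Digraph n → Set
HasArc {n} G = Σ (Fin n) λ a → Σ (Fin n) λ b → G a b ≡ true

arcCount : ∀ {n} → Digraph n → ℕ
arcCount {n} G = sum (map (λ i → sum (map (λ j → if G i j then 1 else 0) (allFin n))) (allFin n))

-- the directed cycle C_k on Fin k : arcs i → i+1 (mod k)
cycle : (k : ℕ) → Digraph k
cycle k i j = toℕ j ≡ᵇ (if suc (toℕ i) ≡ᵇ k then 0 else suc (toℕ i))

-- Blowup B(L): vertex v of L replaced by countably infinite independent set
-- I_v = {v} × ℕ; arcs from I_a to I_b whenever (a,b) ∈ E(L).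
BVertex : ℕ → Set
BVertex n = Fin n × ℕ

BArc : ∀ {n} → Digraph n → BVertex n → BVertex n → Set
BArc L (a , _) (b , _) = L a b ≡ true

ValidAddition : ∀ {n} → Digraph n → List (BVertex n × BVertex n) → Set
ValidAddition {n} L F =
  Unique F × (∀ (p q : BVertex n) → (p , q) ∈ F → (p ≢ q) × (BArc L p q → Data.Empty.⊥))
  where import Data.Empty

ContainsCopy : ∀ {k n} → Digraph k → Digraph n → List (BVertex n × BVertex n) → Set
ContainsCopy {k} {n} H L F =
  Σ (Fin k → BVertex n) λ g → Injective _≡_ _≡_ g ×
    (∀ (u v : Fin k) → H u v ≡ true → BArc L (g u) (g v) ⊎ ((g u , g v) ∈ F))

-- disc_H(L) = d : d is the minimum number of arcs to add to B(L) to obtain a copy of H.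
DiscIs : ∀ {k n} → Digraph k → Digraph n → ℕ → Set
DiscIs H L d =
  (Σ _ λ F → ValidAddition L F × ContainsCopy H L F × length F ≡ d) ×
  (∀ F → ValidAddition L F → ContainsCopy H L F → d ℕ.≤ length F)

-- |E(L)| / |V(L)|^2 (the n = 0 case never arises for graphs with an arc)
density : ℕ → ℕ → ℚ
density e zero = 0ℚ
density e (suc m) = (+ e) / (suc m ℕ.* suc m)

-- f(H,L) given d = disc_H(L)
fval : ∀ {k n} → Digraph k → Digraph n → ℕ → ℚ
fval {n = n} H L d =
  ((+ arcCount H) / 1 * (1ℚ - density (arcCount L) n))
  ⊔ (((+ arcCount H) ℤ.- (+ d)) / 1)

-- f(H) = c : c is the infimum of f(H,L) over directed graphs L with at least one arc.
FIs : ∀ {k} → Digraph k → ℚ → Set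
FIs H c =
  (∀ n (L : Digraph n) → IsDigraph L → HasArc L → ∀ d → DiscIs H L d → c ≤ fval H L d) ×
  (∀ (ε : ℚ) → 0ℚ < ε → Σ ℕ λ n → Σ (Digraph n) λ L → Σ ℕ λ d →
     IsDigraph L × HasArc L × DiscIs H L d × fval H L d < c + ε)

-- Fix q ≥ 1. If L has a walk with q arcs, C_k winds around it in B(L) at the cost of one added arc
-- per q + 1 steps, so disc ≤ ⌈k/(q+1)⌉ and the second term of f(C_k, L) is at least k - ⌈k/(q+1)⌉.
-- Otherwise, ranking each vertex by the length of a longest walk from it gives q ranks that strictly
-- decrease along arcs; comparing ranks of ordered pairs and applying Cauchy–Schwarz to the rank
-- classes bounds the density of L by (q - 1)/(2q), so the first term is at least k(q + 1)/(2q).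
-- With q = 3 (q = 4 for k = 5) both bounds are at least 2k/3 (resp. 25/8). These values are attained
-- by the transitive tournaments T₃ and T₄: levels rise along their arcs, so every copy of C_k in the
-- blowup of T_p needs at least k/p added arcs.
module Submission where

open import Defs
open import Data.Bool as Bool using (Bool; true; false; if_then_else_; T; not)
open import Data.Nat as ℕ using (ℕ; zero; suc; _≡ᵇ_; _<ᵇ_; _+_; _*_; _∸_; _≤_; _<_; z≤n; s≤s)
import Data.Nat.Properties as ℕₚ
open import Data.Nat.Tactic.RingSolver using (solve-∀)
open import Data.Fin using (Fin; toℕ; fromℕ; fromℕ<; inject₁) renaming (zero to fzero; suc to fsuc)
import Data.Fin.Properties as Finₚ
open import Data.List using (List; []; _∷_; map; filter; downFrom; allFin; tabulate; length)
import Data.List.Properties as Listₚ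
import Data.Nat.ListAction as List
open import Data.Integer as ℤ using (+_)
import Data.Integer.Properties as ℤₚ
import Data.Integer.Tactic.RingSolver as ℤSolver
open import Data.Rational as ℚ using (_/_; 1ℚ; 0ℚ; _⊔_; toℚᵘ)
import Data.Rational.Properties as ℚₚ
open import Data.Rational.Unnormalised as ℚᵘ using (mkℚᵘ)
import Data.Rational.Unnormalised.Properties as ℚᵘₚ
open import Data.List.Membership.Propositional using (_∈_)
open import Data.List.Relation.Unary.Any as Any using (here; there; _─_)
import Data.List.Relation.Unary.All as All
open import Data.List.Relation.Unary.AllPairs using (_∷_)
open import Data.List.Relation.Unary.Unique.Propositional using (Unique)
import Data.List.Relation.Unary.Unique.Propositional.Properties as UniqueP
open import Data.List.Membership.Propositional.Properties
  using (∈-map⁺; ∈-filter⁺; ∈-filter⁻; ∈-map∘filter⁻; ∈-downFrom⁺; ∈-downFrom⁻)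
open import Data.Product using (Σ; ∃-syntax; _×_; _,_; proj₁; proj₂)
open import Data.Sum using (_⊎_; inj₁; inj₂)
open import Data.Empty using (⊥-elim)
open import Data.Unit using (⊤; tt)
open import Relation.Nullary using (¬_; Dec; yes; no)
open import Relation.Nullary.Decidable using (_×-dec_)
open import Data.Bool.Properties using (T-≡; T?)
open import Function using (_∘_)
open import Function.Bundles using (Equivalence)
open import Relation.Binary.PropositionalEquality
open import Algebra.Properties.Semiring.Sum ℕₚ.+-*-semiring
  using (sum; sum-syntax; sum-init-last; sum-cong-≗; ∑-distrib-+; ∑-comm; *-distribˡ-sum; *-distribʳ-sum)

indicator : Bool → ℕ
indicator b = if b then 1 else 0

∑-mono-≤ : ∀ {n} {f g : Fin n → ℕ} → (∀ i → f i ≤ g i) → sum f ≤ sum g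
∑-mono-≤ {zero} _ = z≤n
∑-mono-≤ {suc n} f≤g = ℕₚ.+-mono-≤ (f≤g fzero) (∑-mono-≤ (f≤g ∘ fsuc))

∑-const : ∀ n c → ∑[ i < n ] c ≡ n * c
∑-const zero c = refl
∑-const (suc n) c = cong (_+_ c) (∑-const n c)

sum-tabulate : ∀ {n} (f : Fin n → ℕ) → List.sum (tabulate f) ≡ sum f
sum-tabulate {zero} f = refl
sum-tabulate {suc n} f = cong (_+_ (f fzero)) (sum-tabulate (f ∘ fsuc))

sum-map-allFin : ∀ {n} (f : Fin n → ℕ) → List.sum (map f (allFin n)) ≡ sum f
sum-map-allFin {n} f = trans (cong List.sum (Listₚ.map-tabulate (λ i → i) f)) (sum-tabulate f)

arcCount≡∑ : ∀ {n} (G : Digraph n) → arcCount G ≡ ∑[ u < n ] ∑[ v < n ] indicator (G u v)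
arcCount≡∑ {n} G = trans (cong List.sum (Listₚ.map-cong (λ u → sum-map-allFin (indicator ∘ G u)) (allFin n)))
                         (sum-map-allFin (λ u → ∑[ v < n ] indicator (G u v)))

∑-select : ∀ {q} a (f : ℕ → ℕ) → a < q → ∑[ i < q ] (indicator (toℕ i ≡ᵇ a) * f (toℕ i)) ≡ f a
∑-select {suc q} zero f _ =
  trans (cong₂ _+_ (ℕₚ.+-identityʳ (f 0)) (trans (∑-const q 0) (ℕₚ.*-zeroʳ q))) (ℕₚ.+-identityʳ (f 0))
∑-select {suc q} (suc a) f (s≤s a<q) = ∑-select a (f ∘ suc) a<q

∑-indicator : ∀ {q} a → a < q → ∑[ i < q ] indicator (toℕ i ≡ᵇ a) ≡ 1
∑-indicator {q} a a<q = trans (sum-cong-≗ {q} (λ i → sym (ℕₚ.*-identityʳ _))) (∑-select a (λ _ → 1) a<q)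

2mn≤m²+n²-of-≤ : ∀ {m n} → m ≤ n → 2 * (m * n) ≤ m * m + n * n
2mn≤m²+n²-of-≤ {m} m≤n with t , refl ← ℕₚ.m≤n⇒∃[o]m+o≡n m≤n =
  subst (2 * (m * (m + t)) ≤_) (sym (gap m t)) (ℕₚ.m≤m+n _ (t * t))
  where gap : ∀ m t → m * m + (m + t) * (m + t) ≡ 2 * (m * (m + t)) + t * t
        gap = solve-∀

2mn≤m²+n² : ∀ m n → 2 * (m * n) ≤ m * m + n * n
2mn≤m²+n² m n with ℕₚ.≤-total m n
... | inj₁ m≤n = 2mn≤m²+n²-of-≤ m≤n
... | inj₂ n≤m = subst₂ _≤_ (cong (2 *_) (ℕₚ.*-comm n m)) (ℕₚ.+-comm (n * n) (m * m)) (2mn≤m²+n²-of-≤ n≤m)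

cauchy-schwarz : ∀ {q} (x : Fin q → ℕ) → sum x * sum x ≤ q * ∑[ i < q ] (x i * x i)
cauchy-schwarz {zero} x = z≤n
cauchy-schwarz {suc q} x = begin
  (a + S) * (a + S)               ≡⟨ square-expand a S ⟩
  a * a + 2 * (a * S) + S * S     ≤⟨ ℕₚ.+-mono-≤ (ℕₚ.+-monoʳ-≤ (a * a) cross) (cauchy-schwarz (x ∘ fsuc)) ⟩
  a * a + (q * (a * a) + S₂) + q * S₂ ≡⟨ regroup a q S₂ ⟩
  suc q * (a * a + S₂) ∎
  where
  open ℕₚ.≤-Reasoning
  a S S₂ : ℕ
  a = x fzero
  S = sum (x ∘ fsuc)
  S₂ = ∑[ i < q ] (x (fsuc i) * x (fsuc i))
  cross : 2 * (a * S) ≤ q * (a * a) + S₂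
  cross = begin
    2 * (a * S)                             ≡⟨ cong (2 *_) (*-distribˡ-sum a (x ∘ fsuc)) ⟩
    2 * ∑[ i < q ] (a * x (fsuc i))         ≡⟨ *-distribˡ-sum 2 (λ i → a * x (fsuc i)) ⟩
    ∑[ i < q ] (2 * (a * x (fsuc i)))       ≤⟨ ∑-mono-≤ (λ i → 2mn≤m²+n² a (x (fsuc i))) ⟩
    ∑[ i < q ] (a * a + x (fsuc i) * x (fsuc i)) ≡⟨ ∑-distrib-+ (λ _ → a * a) (λ i → x (fsuc i) * x (fsuc i)) ⟩
    ∑[ i < q ] (a * a) + S₂                 ≡⟨ cong (_+ S₂) (∑-const q (a * a)) ⟩
    q * (a * a) + S₂ ∎
  square-expand : ∀ a s → (a + s) * (a + s) ≡ a * a + 2 * (a * s) + s * s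
  square-expand = solve-∀
  regroup : ∀ a q s → a * a + (q * (a * a) + s) + q * s ≡ suc q * (a * a + s)
  regroup = solve-∀

∑-distrib-+₃ : ∀ {n} (f g k : Fin n → ℕ) → sum f + sum g + sum k ≡ ∑[ i < n ] (f i + g i + k i)
∑-distrib-+₃ f g k = trans (cong (_+ sum k) (sym (∑-distrib-+ f g))) (sym (∑-distrib-+ (λ i → f i + g i) k))

indicator-mono : ∀ {a b} → (T a → T b) → indicator a ≤ indicator b
indicator-mono {false} _ = z≤n
indicator-mono {true} {false} a⇒b = ⊥-elim (a⇒b _)
indicator-mono {true} {true} _ = ℕₚ.≤-refl

indicator-trichotomy : ∀ m n → indicator (m <ᵇ n) + indicator (n <ᵇ m) + indicator (n ≡ᵇ m) ≡ 1
indicator-trichotomy zero zero = refl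
indicator-trichotomy zero (suc n) = refl
indicator-trichotomy (suc m) zero = refl
indicator-trichotomy (suc m) (suc n) = indicator-trichotomy m n

module _ {n : ℕ} (rank : Fin n → ℕ) where

  descendingPairs : ℕ
  descendingPairs = ∑[ u < n ] ∑[ v < n ] indicator (rank v <ᵇ rank u)

  levelPairs : ℕ
  levelPairs = ∑[ u < n ] ∑[ v < n ] indicator (rank u ≡ᵇ rank v)

  fibre : ℕ → ℕ
  fibre i = ∑[ u < n ] indicator (i ≡ᵇ rank u)

  arcCount≤descendingPairs : (L : Digraph n) → (∀ u v → L u v ≡ true → rank v < rank u) →
                             arcCount L ≤ descendingPairs
  arcCount≤descendingPairs L descends = begin
    arcCount L                                  ≡⟨ arcCount≡∑ L ⟩
    ∑[ u < n ] ∑[ v < n ] indicator (L u v)     ≤⟨ ∑-mono-≤ (λ u → ∑-mono-≤ (arc≤ u)) ⟩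
    descendingPairs                             ∎
    where
    open ℕₚ.≤-Reasoning
    arc≤ : ∀ u v → indicator (L u v) ≤ indicator (rank v <ᵇ rank u)
    arc≤ u v = indicator-mono (λ arc → ℕₚ.<⇒<ᵇ (descends u v (Equivalence.to T-≡ arc)))

  2*descendingPairs+levelPairs≡n² : 2 * descendingPairs + levelPairs ≡ n * n
  2*descendingPairs+levelPairs≡n² = begin
    2 * descendingPairs + levelPairs
      ≡⟨ cong (_+ levelPairs) (cong (_+_ descendingPairs) (ℕₚ.+-identityʳ descendingPairs)) ⟩
    descendingPairs + descendingPairs + levelPairs
      ≡⟨ cong (λ t → descendingPairs + t + levelPairs) (∑-comm {n} {n} (λ u v → indicator (rank u <ᵇ rank v))) ⟨
    ∑[ u < n ] ∑[ v < n ] indicator (rank v <ᵇ rank u) + ∑[ u < n ] ∑[ v < n ] indicator (rank u <ᵇ rank v) + levelPairs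
      ≡⟨ ∑-distrib-+₃ {n} _ _ _ ⟩
    ∑[ u < n ] (∑[ v < n ] indicator (rank v <ᵇ rank u) + ∑[ v < n ] indicator (rank u <ᵇ rank v)
                + ∑[ v < n ] indicator (rank u ≡ᵇ rank v))
      ≡⟨ sum-cong-≗ {n} (λ u → trans (∑-distrib-+₃ {n} _ _ _)
                                     (sum-cong-≗ {n} (λ v → indicator-trichotomy (rank v) (rank u)))) ⟩
    ∑[ u < n ] ∑[ v < n ] 1
      ≡⟨ trans (∑-const n (∑[ v < n ] 1)) (cong (n *_) (trans (∑-const n 1) (ℕₚ.*-identityʳ n))) ⟩
    n * n ∎
    where open ≡-Reasoning

  module _ {q : ℕ} (rank<q : ∀ u → rank u < q) where

    ∑-fibre : ∑[ i < q ] fibre (toℕ i) ≡ n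
    ∑-fibre = begin
      ∑[ i < q ] ∑[ u < n ] indicator (toℕ i ≡ᵇ rank u)         ≡⟨ ∑-comm {q} {n} (λ i u → indicator (toℕ i ≡ᵇ rank u)) ⟩
      ∑[ u < n ] ∑[ i < q ] indicator (toℕ i ≡ᵇ rank u)         ≡⟨ sum-cong-≗ {n} (λ u → ∑-indicator (rank u) (rank<q u)) ⟩
      ∑[ u < n ] 1                                           ≡⟨ trans (∑-const n 1) (ℕₚ.*-identityʳ n) ⟩
      n ∎
      where open ≡-Reasoning

    levelPairs≡∑fibre² : levelPairs ≡ ∑[ i < q ] (fibre (toℕ i) * fibre (toℕ i))
    levelPairs≡∑fibre² = begin
      ∑[ u < n ] ∑[ v < n ] indicator (rank u ≡ᵇ rank v)
        ≡⟨ sum-cong-≗ {n} (λ u → sum-cong-≗ {n} (λ v → sym (∑-select (rank u) (λ t → indicator (t ≡ᵇ rank v)) (rank<q u)))) ⟩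
      ∑[ u < n ] ∑[ v < n ] ∑[ i < q ] (member i u * member i v)
        ≡⟨ sum-cong-≗ {n} (λ u → ∑-comm {n} {q} (λ v i → member i u * member i v)) ⟩
      ∑[ u < n ] ∑[ i < q ] ∑[ v < n ] (member i u * member i v)
        ≡⟨ sum-cong-≗ {n} (λ u → sum-cong-≗ {q} (λ i → sym (*-distribˡ-sum (member i u) (member i)))) ⟩
      ∑[ u < n ] ∑[ i < q ] (member i u * fibre (toℕ i))
        ≡⟨ ∑-comm {n} {q} (λ u i → member i u * fibre (toℕ i)) ⟩
      ∑[ i < q ] ∑[ u < n ] (member i u * fibre (toℕ i))
        ≡⟨ sum-cong-≗ {q} (λ i → sym (*-distribʳ-sum (fibre (toℕ i)) (λ u → member i u))) ⟩
      ∑[ i < q ] (fibre (toℕ i) * fibre (toℕ i)) ∎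
      where
      open ≡-Reasoning
      member : Fin q → Fin n → ℕ
      member i u = indicator (toℕ i ≡ᵇ rank u)

    n²≤q*levelPairs : n * n ≤ q * levelPairs
    n²≤q*levelPairs = begin
      n * n                                         ≡⟨ cong₂ _*_ ∑-fibre ∑-fibre ⟨
      sum {q} (fibre ∘ toℕ) * sum {q} (fibre ∘ toℕ) ≤⟨ cauchy-schwarz {q} (fibre ∘ toℕ) ⟩
      q * ∑[ i < q ] (fibre (toℕ i) * fibre (toℕ i)) ≡⟨ cong (q *_) levelPairs≡∑fibre² ⟨
      q * levelPairs ∎
      where open ℕₚ.≤-Reasoning

ranked-arcCount-bound : ∀ {n q} (L : Digraph n) (rank : Fin n → ℕ) → (∀ u → rank u < q) →
                        (∀ u v → L u v ≡ true → rank v < rank u) →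
                        2 * q * arcCount L + n * n ≤ q * (n * n)
ranked-arcCount-bound {n} {q} L rank rank<q descends = begin
  2 * q * arcCount L + n * n          ≤⟨ ℕₚ.+-mono-≤ (ℕₚ.*-monoʳ-≤ (2 * q) (arcCount≤descendingPairs rank L descends))
                                                      (n²≤q*levelPairs rank rank<q) ⟩
  2 * q * A + q * levelPairs rank     ≡⟨ distribute q A (levelPairs rank) ⟩
  q * (2 * A + levelPairs rank)       ≡⟨ cong (q *_) (2*descendingPairs+levelPairs≡n² rank) ⟩
  q * (n * n) ∎
  where
  open ℕₚ.≤-Reasoning
  A : ℕ
  A = descendingPairs rank
  distribute : ∀ q a d → 2 * q * a + q * d ≡ q * (2 * a + d)
  distribute = solve-∀

module _ {n : ℕ} (L : Digraph n) where

  WalkFrom : ℕ → Fin n → Set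
  WalkFrom zero v = ⊤
  WalkFrom (suc j) v = ∃[ u ] L v u ≡ true × WalkFrom j u

  walkFrom? : ∀ j v → Dec (WalkFrom j v)
  walkFrom? zero v = yes tt
  walkFrom? (suc j) v = Finₚ.any? (λ u → (L v u Bool.≟ true) ×-dec walkFrom? j u)

  -- The r-th vertex of a walk; constant once the walk has ended.
  walkVertex : ∀ {j v} → WalkFrom j v → ℕ → Fin n
  walkVertex {zero} {v} _ _ = v
  walkVertex {suc j} {v} _ zero = v
  walkVertex {suc j} (_ , _ , p) (suc r) = walkVertex p r

  walkVertex-zero : ∀ {j v} (p : WalkFrom j v) → walkVertex p 0 ≡ v
  walkVertex-zero {zero} _ = refl
  walkVertex-zero {suc j} _ = refl

  walkVertex-arc : ∀ {j v} (p : WalkFrom j v) r → r < j → L (walkVertex p r) (walkVertex p (suc r)) ≡ true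
  walkVertex-arc {suc j} {v} (_ , vu , p) zero _ = subst (λ x → L v x ≡ true) (sym (walkVertex-zero p)) vu
  walkVertex-arc {suc j} (_ , _ , p) (suc r) (s≤s r<j) = walkVertex-arc p r r<j

  depth : ℕ → Fin n → ℕ
  depth zero v = 0
  depth (suc j) v with walkFrom? (suc j) v
  ... | yes _ = suc j
  ... | no _ = depth j v

  walkFrom-depth : ∀ j v → WalkFrom (depth j v) v
  walkFrom-depth zero v = tt
  walkFrom-depth (suc j) v with walkFrom? (suc j) v
  ... | yes p = p
  ... | no _ = walkFrom-depth j v

  depth≤ : ∀ j v → depth j v ≤ j
  depth≤ zero v = z≤n
  depth≤ (suc j) v with walkFrom? (suc j) v
  ... | yes _ = ℕₚ.≤-refl
  ... | no _ = ℕₚ.m≤n⇒m≤1+n (depth≤ j v)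

  depth-maximal : ∀ {i} j v → i ≤ j → WalkFrom i v → i ≤ depth j v
  depth-maximal zero v i≤0 _ = i≤0
  depth-maximal (suc j) v i≤1+j p with walkFrom? (suc j) v
  ... | yes _ = i≤1+j
  ... | no ¬p with ℕₚ.m≤n⇒m<n∨m≡n i≤1+j
  ...   | inj₁ (s≤s i≤j) = depth-maximal j v i≤j p
  ...   | inj₂ refl = ⊥-elim (¬p p)

  depth-descends : ∀ j → (∀ v → ¬ WalkFrom (suc j) v) → ∀ u v → L u v ≡ true → depth j v < depth j u
  depth-descends j noWalk u v uv with ℕₚ.m≤n⇒m<n∨m≡n (depth≤ j v)
  ... | inj₁ depth<j = depth-maximal j u depth<j (v , uv , walkFrom-depth j v)
  ... | inj₂ depth≡j = ⊥-elim (noWalk u (v , uv , subst (λ i → WalkFrom i v) depth≡j (walkFrom-depth j v)))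

∈-─⁺ : ∀ {A : Set} {x y : A} {xs} (x∈xs : x ∈ xs) → y ≢ x → y ∈ xs → y ∈ (xs ─ x∈xs)
∈-─⁺ (here refl) y≢x (here refl) = ⊥-elim (y≢x refl)
∈-─⁺ (here _) _ (there y∈xs) = y∈xs
∈-─⁺ (there _) _ (here y≡x) = here y≡x
∈-─⁺ (there x∈xs) y≢x (there y∈xs) = there (∈-─⁺ x∈xs y≢x y∈xs)

unique-⊆⇒length≤ : ∀ {A : Set} {xs ys : List A} → Unique xs → (∀ {x} → x ∈ xs → x ∈ ys) → length xs ≤ length ys
unique-⊆⇒length≤ {xs = []} _ _ = z≤n
unique-⊆⇒length≤ {xs = x ∷ xs} {ys} (x∉xs ∷ unique) xs⊆ys =
  subst (suc (length xs) ≤_) (sym (Listₚ.length-removeAt′ ys (Any.index x∈ys)))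
    (s≤s (unique-⊆⇒length≤ unique (λ y∈xs → ∈-─⁺ x∈ys (λ y≡x → All.lookup x∉xs y∈xs (sym y≡x)) (xs⊆ys (there y∈xs)))))
  where
  x∈ys : x ∈ ys
  x∈ys = xs⊆ys (here refl)

-- cycle k i j is, by definition, toℕ j ≡ᵇ cycleSucc k (toℕ i).
cycleSucc : ℕ → ℕ → ℕ
cycleSucc k u = if suc u ≡ᵇ k then 0 else suc u

cycleSucc-inner : ∀ {k u} → suc u < k → cycleSucc k u ≡ suc u
cycleSucc-inner {k} {u} 1+u<k with suc u ≡ᵇ k in eq
... | false = refl
... | true = ⊥-elim (ℕₚ.<-irrefl (ℕₚ.≡ᵇ⇒≡ (suc u) k (Equivalence.from T-≡ eq)) 1+u<k)

cycleSucc-last : ∀ u → cycleSucc (suc u) u ≡ 0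
cycleSucc-last u with suc u ≡ᵇ suc u in eq
... | true = refl
... | false = ⊥-elim (subst T eq (ℕₚ.≡⇒≡ᵇ (suc u) (suc u) refl))

cycleSucc<k : ∀ {k u} → u < k → cycleSucc k u < k
cycleSucc<k {k} {u} u<k with ℕₚ.m≤n⇒m<n∨m≡n u<k
... | inj₁ 1+u<k = subst (_< k) (sym (cycleSucc-inner 1+u<k)) 1+u<k
... | inj₂ refl = subst (_< suc u) (sym (cycleSucc-last u)) (s≤s z≤n)

cycleSucc≢ : ∀ {k u} → 2 ≤ k → u < k → cycleSucc k u ≢ u
cycleSucc≢ {k} {u} 2≤k u<k with ℕₚ.m≤n⇒m<n∨m≡n u<k
... | inj₁ 1+u<k = ℕₚ.1+n≢n ∘ trans (sym (cycleSucc-inner 1+u<k))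
... | inj₂ refl = λ 0≡u → ℕₚ.<-irrefl (cong suc (trans (sym (cycleSucc-last u)) 0≡u)) 2≤k

arcCount-cycle : ∀ k → arcCount (cycle k) ≡ k
arcCount-cycle k = begin
  arcCount (cycle k)                                         ≡⟨ arcCount≡∑ (cycle k) ⟩
  ∑[ i < k ] ∑[ j < k ] indicator (cycle k i j)              ≡⟨ sum-cong-≗ {k} (λ i → ∑-indicator _ (cycleSucc<k (Finₚ.toℕ<n i))) ⟩
  ∑[ i < k ] 1                                               ≡⟨ trans (∑-const k 1) (ℕₚ.*-identityʳ k) ⟩
  k ∎
  where open ≡-Reasoning

-- Position u of C_k sits in the copy of w (phase u), the phase running 0, 1, …, q, 0, 1, …; only
-- the steps jumping back to w 0, and the step closing the cycle, may miss an arc of L.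
module WindAround (k : ℕ) (2≤k : 2 ≤ k) {n : ℕ} (L : Digraph n) (q : ℕ) (w : ℕ → Fin n)
                  (walk : ∀ r → r < q → L (w r) (w (suc r)) ≡ true) where

  phase : ℕ → ℕ
  phase zero = 0
  phase (suc u) = if phase u ≡ᵇ q then 0 else suc (phase u)

  phase≤q : ∀ u → phase u ≤ q
  phase≤q zero = z≤n
  phase≤q (suc u) with phase u ≡ᵇ q in eq
  ... | true = z≤n
  ... | false = ℕₚ.≤∧≢⇒< (phase≤q u) (λ phase≡q → subst T eq (ℕₚ.≡⇒≡ᵇ _ _ phase≡q))

  place : ℕ → BVertex n
  place u = w (phase u) , u

  step : ℕ → BVertex n × BVertex n
  step u = place u , place (cycleSucc k u)

  missing : ℕ → Bool
  missing u = not (L (w (phase u)) (w (phase (cycleSucc k u))))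

  missingSteps : List ℕ
  missingSteps = filter (λ u → T? (missing u)) (downFrom k)

  added : List (BVertex n × BVertex n)
  added = map step missingSteps

  missingSteps-unique : Unique missingSteps
  missingSteps-unique = UniqueP.filter⁺ (λ u → T? (missing u)) (UniqueP.downFrom⁺ k)

  step-injective : ∀ {u v} → step u ≡ step v → u ≡ v
  step-injective = cong (proj₂ ∘ proj₁)

  walk-step : ∀ u → suc u < k → phase u ≢ q → L (w (phase u)) (w (phase (cycleSucc k u))) ≡ true
  walk-step u 1+u<k phase≢q with phase u ≡ᵇ q in eq
  ... | true = ⊥-elim (phase≢q (ℕₚ.≡ᵇ⇒≡ _ _ (Equivalence.from T-≡ eq)))
  ... | false rewrite cycleSucc-inner 1+u<k | eq = walk (phase u) (ℕₚ.≤∧≢⇒< (phase≤q u) phase≢q)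

  step-covered : ∀ u → u < k → BArc L (place u) (place (cycleSucc k u)) ⊎ step u ∈ added
  step-covered u u<k with L (w (phase u)) (w (phase (cycleSucc k u))) in arc
  ... | true = inj₁ refl
  ... | false = inj₂ (∈-map⁺ step (∈-filter⁺ (λ u → T? (missing u)) (∈-downFrom⁺ u<k) (subst (T ∘ not) (sym arc) tt)))

  winding : ContainsCopy (cycle k) L added
  winding = place ∘ toℕ , (Finₚ.toℕ-injective ∘ cong proj₂) , covered
    where
    covered : ∀ i j → cycle k i j ≡ true →
              BArc L (place (toℕ i)) (place (toℕ j)) ⊎ (place (toℕ i) , place (toℕ j)) ∈ added
    covered i j ij rewrite ℕₚ.≡ᵇ⇒≡ (toℕ j) _ (Equivalence.from T-≡ ij) = step-covered (toℕ i) (Finₚ.toℕ<n i)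

  winding-valid : ValidAddition L added
  winding-valid = UniqueP.map⁺ step-injective missingSteps-unique , fresh
    where
    fresh : ∀ a b → (a , b) ∈ added → a ≢ b × ¬ BArc L a b
    fresh a b ab∈ with u , u∈ , refl , missing-u ← ∈-map∘filter⁻ step (λ u → T? (missing u)) ab∈ =
        (λ loop → cycleSucc≢ 2≤k (∈-downFrom⁻ u∈) (sym (cong proj₂ loop)))
      , (λ arc → subst (T ∘ not) arc missing-u)

  wrapSteps : ℕ → List ℕ
  wrapSteps m = filter (λ u → T? (phase u ≡ᵇ q)) (downFrom m)

  wrapSteps-count : ∀ m → length (wrapSteps m) * suc q + phase m ≡ m
  wrapSteps-count zero = refl
  wrapSteps-count (suc m) with phase m ≡ᵇ q in eq
  ... | false = trans (ℕₚ.+-suc _ _) (cong suc (wrapSteps-count m))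
  ... | true = begin
    suc W * suc q + 0        ≡⟨ regroup W q ⟩
    suc (W * suc q + q)      ≡⟨ cong (λ p → suc (W * suc q + p)) (ℕₚ.≡ᵇ⇒≡ _ _ (Equivalence.from T-≡ eq)) ⟨
    suc (W * suc q + phase m) ≡⟨ cong suc (wrapSteps-count m) ⟩
    suc m ∎
    where
    open ≡-Reasoning
    W : ℕ
    W = length (wrapSteps m)
    regroup : ∀ w q → suc w * suc q + 0 ≡ suc (w * suc q + q)
    regroup = solve-∀

  missing⇒wrap : ∀ u → suc u < k → T (missing u) → T (phase u ≡ᵇ q)
  missing⇒wrap u 1+u<k missing-u with phase u ≡ᵇ q in eq
  ... | true = tt
  ... | false = subst (T ∘ not) (walk-step u 1+u<k (λ phase≡q → subst T eq (ℕₚ.≡⇒≡ᵇ _ _ phase≡q))) missing-u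

  private
    m : ℕ
    m = ℕ.pred k

    k≡1+m : k ≡ suc m
    k≡1+m = sym (ℕₚ.suc-pred k {{ℕ.>-nonZero (ℕₚ.≤-trans (s≤s z≤n) 2≤k)}})

  missingSteps⊆ : ∀ {u} → u ∈ missingSteps → u ∈ m ∷ wrapSteps m
  missingSteps⊆ {u} u∈ with u∈k , missing-u ← ∈-filter⁻ (λ u → T? (missing u)) u∈
                       with ℕₚ.m≤n⇒m<n∨m≡n (∈-downFrom⁻ u∈k)
  ... | inj₂ 1+u≡k = here (ℕₚ.suc-injective (trans 1+u≡k k≡1+m))
  ... | inj₁ 1+u<k = there (∈-filter⁺ (λ u → T? (phase u ≡ᵇ q))
                                      (∈-downFrom⁺ (ℕₚ.≤-pred (subst (suc (suc u) ≤_) k≡1+m 1+u<k)))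
                                      (missing⇒wrap u 1+u<k missing-u))

  added-length : length added * suc q ≤ k + q
  added-length = begin
    length added * suc q           ≡⟨ cong (_* suc q) (Listₚ.length-map step missingSteps) ⟩
    length missingSteps * suc q    ≤⟨ ℕₚ.*-monoˡ-≤ (suc q) (unique-⊆⇒length≤ missingSteps-unique missingSteps⊆) ⟩
    suc q + W * suc q              ≤⟨ ℕₚ.+-monoʳ-≤ (suc q) (subst (W * suc q ≤_) (wrapSteps-count m) (ℕₚ.m≤m+n _ _)) ⟩
    suc q + m                      ≡⟨ cong suc (ℕₚ.+-comm q m) ⟩
    suc m + q                      ≡⟨ cong (_+ q) k≡1+m ⟨
    k + q ∎
    where
    open ℕₚ.≤-Reasoning
    W : ℕ
    W = length (wrapSteps m)

cycleNext : ∀ {k} → Fin k → Fin k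
cycleNext i = fromℕ< (cycleSucc<k (Finₚ.toℕ<n i))

toℕ-cycleNext : ∀ {k} (i : Fin k) → toℕ (cycleNext i) ≡ cycleSucc k (toℕ i)
toℕ-cycleNext i = Finₚ.toℕ-fromℕ< (cycleSucc<k (Finₚ.toℕ<n i))

cycle-cycleNext : ∀ {k} (i : Fin k) → cycle k i (cycleNext i) ≡ true
cycle-cycleNext i = Equivalence.to T-≡ (ℕₚ.≡⇒≡ᵇ _ _ (toℕ-cycleNext i))

∑-cycleNext : ∀ {m} (f : Fin (suc m) → ℕ) → sum (f ∘ cycleNext) ≡ sum f
∑-cycleNext {m} f = begin
  sum (f ∘ cycleNext)                              ≡⟨ sum-init-last (f ∘ cycleNext) ⟩
  sum (f ∘ cycleNext ∘ inject₁) + f (cycleNext (fromℕ m)) ≡⟨ cong₂ _+_ (sum-cong-≗ {m} (cong f ∘ next-inject₁)) (cong f next-last) ⟩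
  sum (f ∘ fsuc) + f fzero                          ≡⟨ ℕₚ.+-comm _ (f fzero) ⟩
  sum f ∎
  where
  open ≡-Reasoning
  next-inject₁ : ∀ i → cycleNext (inject₁ i) ≡ fsuc i
  next-inject₁ i = Finₚ.toℕ-injective (begin
    toℕ (cycleNext (inject₁ i))        ≡⟨ toℕ-cycleNext (inject₁ i) ⟩
    cycleSucc (suc m) (toℕ (inject₁ i)) ≡⟨ cong (cycleSucc (suc m)) (Finₚ.toℕ-inject₁ i) ⟩
    cycleSucc (suc m) (toℕ i)           ≡⟨ cycleSucc-inner (s≤s (Finₚ.toℕ<n i)) ⟩
    suc (toℕ i) ∎)
  next-last : cycleNext (fromℕ m) ≡ fzero
  next-last = Finₚ.toℕ-injective (begin
    toℕ (cycleNext (fromℕ m))           ≡⟨ toℕ-cycleNext (fromℕ m) ⟩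
    cycleSucc (suc m) (toℕ (fromℕ m))   ≡⟨ cong (cycleSucc (suc m)) (Finₚ.toℕ-fromℕ m) ⟩
    cycleSucc (suc m) m                 ≡⟨ cycleSucc-last m ⟩
    0 ∎)

transitiveTournament : (p : ℕ) → Digraph p
transitiveTournament p a b = toℕ a <ᵇ toℕ b

<ᵇ-irrefl : ∀ n → (n <ᵇ n) ≡ false
<ᵇ-irrefl zero = refl
<ᵇ-irrefl (suc n) = <ᵇ-irrefl n

transitiveTournament-isDigraph : ∀ p → IsDigraph (transitiveTournament p)
transitiveTournament-isDigraph p = <ᵇ-irrefl ∘ toℕ

-- The walk 0 → 1 → … → q in T_{q+1}, staying at q afterwards.
ascent : ∀ q → ℕ → Fin (suc q)
ascent q r = fromℕ< (s≤s (ℕₚ.m⊓n≤n r q))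

toℕ-ascent : ∀ {q r} → r ≤ q → toℕ (ascent q r) ≡ r
toℕ-ascent {q} {r} r≤q = trans (Finₚ.toℕ-fromℕ< (s≤s (ℕₚ.m⊓n≤n r q))) (ℕₚ.m≤n⇒m⊓n≡m r≤q)

transitiveTournament-walk : ∀ q r → r < q → transitiveTournament (suc q) (ascent q r) (ascent q (suc r)) ≡ true
transitiveTournament-walk q r r<q = Equivalence.to T-≡
  (subst₂ (λ a b → T (a <ᵇ b)) (sym (toℕ-ascent (ℕₚ.<⇒≤ r<q))) (sym (toℕ-ascent r<q)) (ℕₚ.<⇒<ᵇ (ℕₚ.n<1+n r)))

length-filter-tabulate : ∀ {A : Set} {k} (f : Fin k → A) (P : A → Bool) →
                         length (filter (λ x → T? (P x)) (tabulate f)) ≡ ∑[ i < k ] indicator (P (f i))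
length-filter-tabulate {k = zero} f P = refl
length-filter-tabulate {k = suc k} f P with P (f fzero)
... | true = cong suc (length-filter-tabulate (f ∘ fsuc) P)
... | false = length-filter-tabulate (f ∘ fsuc) P

-- Levels in T_p rise along its arcs and lie in [0, p), so around a copy of C_k the added arcs must
-- absorb a total rise of at least k, each at most p.
transitiveTournament-copy-cost : ∀ {p m} F → ContainsCopy (cycle (suc m)) (transitiveTournament p) F →
                                 suc m ≤ p * length F
transitiveTournament-copy-cost {p} {m} F (g , g-injective , covered) = ℕₚ.+-cancelˡ-≤ (sum level) _ _ (begin
  sum level + k                                           ≡⟨ cong (_+_ (sum level)) (trans (∑-const k 1) (ℕₚ.*-identityʳ k)) ⟨
  sum level + ∑[ i < k ] 1                                ≡⟨ ∑-distrib-+ level (λ _ → 1) ⟨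
  ∑[ i < k ] (level i + 1)                                ≤⟨ ∑-mono-≤ climb ⟩
  ∑[ i < k ] (level (cycleNext i) + p * indicator (descent i)) ≡⟨ ∑-distrib-+ (level ∘ cycleNext) (λ i → p * indicator (descent i)) ⟩
  sum (level ∘ cycleNext) + ∑[ i < k ] (p * indicator (descent i))
    ≡⟨ cong₂ _+_ (∑-cycleNext level) (sym (*-distribˡ-sum p (indicator ∘ descent))) ⟩
  sum level + p * ∑[ i < k ] indicator (descent i)        ≤⟨ ℕₚ.+-monoʳ-≤ (sum level) (ℕₚ.*-monoʳ-≤ p descents≤added) ⟩
  sum level + p * length F ∎)
  where
  open ℕₚ.≤-Reasoning
  k : ℕ
  k = suc m
  level : Fin k → ℕ
  level i = toℕ (proj₁ (g i))
  descent : Fin k → Bool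
  descent i = not (level i <ᵇ level (cycleNext i))
  climb : ∀ i → level i + 1 ≤ level (cycleNext i) + p * indicator (descent i)
  climb i with level i <ᵇ level (cycleNext i) in rise
  ... | true = subst₂ _≤_ (ℕₚ.+-comm 1 (level i)) (sym (trans (cong (_+_ (level (cycleNext i))) (ℕₚ.*-zeroʳ p)) (ℕₚ.+-identityʳ _)))
                      (ℕₚ.<ᵇ⇒< _ _ (Equivalence.from T-≡ rise))
  ... | false = ℕₚ.≤-trans (subst (_≤ p) (ℕₚ.+-comm 1 (level i)) (Finₚ.toℕ<n (proj₁ (g i))))
                           (ℕₚ.≤-trans (ℕₚ.≤-reflexive (sym (ℕₚ.*-identityʳ p))) (ℕₚ.m≤n+m _ _))
  descentArc : Fin k → BVertex p × BVertex p
  descentArc i = g i , g (cycleNext i)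
  descentArcs : List (BVertex p × BVertex p)
  descentArcs = map descentArc (filter (λ i → T? (descent i)) (allFin k))
  descentArcs⊆F : ∀ {x} → x ∈ descentArcs → x ∈ F
  descentArcs⊆F x∈ with i , _ , refl , descent-i ← ∈-map∘filter⁻ descentArc (λ i → T? (descent i)) x∈
                    with covered i (cycleNext i) (cycle-cycleNext i)
  ... | inj₁ rise = ⊥-elim (subst (T ∘ not) rise descent-i)
  ... | inj₂ added = added
  descents≤added : ∑[ i < k ] indicator (descent i) ≤ length F
  descents≤added = begin
    ∑[ i < k ] indicator (descent i)                         ≡⟨ length-filter-tabulate (λ i → i) descent ⟨
    length (filter (λ i → T? (descent i)) (allFin k))        ≡⟨ Listₚ.length-map descentArc (filter (λ i → T? (descent i)) (allFin k)) ⟨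
    length descentArcs                                       ≤⟨ unique-⊆⇒length≤ unique descentArcs⊆F ⟩
    length F ∎
    where
    unique : Unique descentArcs
    unique = UniqueP.map⁺ (g-injective ∘ cong proj₁) (UniqueP.filter⁺ (λ i → T? (descent i)) (UniqueP.allFin⁺ k))

/-mono-≤ : ∀ {a b m n} → a * suc n ≤ b * suc m → (+ a) / suc m ℚ.≤ (+ b) / suc n
/-mono-≤ {a} {b} {m} {n} a*n≤b*m = ℚₚ.toℚᵘ-cancel-≤
  (ℚᵘₚ.≤-respˡ-≃ (ℚᵘₚ.≃-sym (ℚₚ.toℚᵘ-fromℚᵘ (mkℚᵘ (+ a) m)))
    (ℚᵘₚ.≤-respʳ-≃ (ℚᵘₚ.≃-sym (ℚₚ.toℚᵘ-fromℚᵘ (mkℚᵘ (+ b) n)))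
      (ℚᵘ.*≤* (subst₂ ℤ._≤_ (ℤₚ.pos-* a (suc n)) (ℤₚ.pos-* b (suc m)) (ℤ.+≤+ a*n≤b*m)))))

-- The cross-multiplied form of K (1 - e/N) = K (N - e)/N, as computed on unnormalised fractions.
density-term-numerator : ∀ K e N → e ≤ N →
  (+ K ℤ.* (+ 1 ℤ.* + N ℤ.+ (ℤ.- + e) ℤ.* + 1)) ℤ.* + N ≡ + (K * (N ∸ e)) ℤ.* + (1 * (1 * N))
density-term-numerator K e N e≤N = begin
  (+ K ℤ.* (+ 1 ℤ.* + N ℤ.+ (ℤ.- + e) ℤ.* + 1)) ℤ.* + N ≡⟨ simplify (+ K) (+ N) (+ e) ⟩
  (+ K ℤ.* (+ N ℤ.- + e)) ℤ.* + N                       ≡⟨ cong (λ x → (+ K ℤ.* x) ℤ.* + N) (trans (ℤₚ.m-n≡m⊖n N e) (ℤₚ.⊖-≥ e≤N)) ⟩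
  (+ K ℤ.* + (N ∸ e)) ℤ.* + N
    ≡⟨ cong₂ ℤ._*_ (ℤₚ.pos-* K (N ∸ e)) (cong +_ (trans (ℕₚ.*-identityˡ (1 * N)) (ℕₚ.*-identityˡ N))) ⟨
  + (K * (N ∸ e)) ℤ.* + (1 * (1 * N)) ∎
  where
  open ≡-Reasoning
  simplify : ∀ k n e → (k ℤ.* (+ 1 ℤ.* n ℤ.+ (ℤ.- e) ℤ.* + 1)) ℤ.* n ≡ (k ℤ.* (n ℤ.- e)) ℤ.* n
  simplify = ℤSolver.solve-∀

density-term : ∀ K e M → e ≤ suc M → (+ K) / 1 ℚ.* (1ℚ ℚ.- (+ e) / suc M) ≡ (+ (K * (suc M ∸ e))) / suc M
density-term K e M e≤N = ℚₚ.toℚᵘ-injective (begin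
  toℚᵘ ((+ K) / 1 ℚ.* (1ℚ ℚ.- (+ e) / N))                  ≈⟨ ℚₚ.toℚᵘ-homo-* ((+ K) / 1) (1ℚ ℚ.- (+ e) / N) ⟩
  toℚᵘ ((+ K) / 1) ℚᵘ.* toℚᵘ (1ℚ ℚ.- (+ e) / N)            ≈⟨ ℚᵘₚ.*-cong {toℚᵘ ((+ K) / 1)} (ℚₚ.toℚᵘ-fromℚᵘ (mkℚᵘ (+ K) 0)) complement ⟩
  mkℚᵘ (+ K) 0 ℚᵘ.* (mkℚᵘ (+ 1) 0 ℚᵘ.+ ℚᵘ.- mkℚᵘ (+ e) M)    ≈⟨ ℚᵘ.*≡* (density-term-numerator K e N e≤N) ⟩
  mkℚᵘ (+ (K * (N ∸ e))) M                                  ≈⟨ ℚₚ.toℚᵘ-fromℚᵘ (mkℚᵘ (+ (K * (N ∸ e))) M) ⟨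
  toℚᵘ ((+ (K * (N ∸ e))) / N) ∎)
  where
  open ℚᵘₚ.≃-Reasoning
  N : ℕ
  N = suc M
  complement : toℚᵘ (1ℚ ℚ.- (+ e) / N) ℚᵘ.≃ mkℚᵘ (+ 1) 0 ℚᵘ.+ ℚᵘ.- mkℚᵘ (+ e) M
  complement = ℚᵘₚ.≃-trans (ℚₚ.toℚᵘ-homo-+ 1ℚ (ℚ.- ((+ e) / N)))
    (ℚᵘₚ.+-cong {toℚᵘ 1ℚ} {mkℚᵘ (+ 1) 0} ℚᵘₚ.≃-refl
      (ℚᵘₚ.≃-trans (ℚₚ.toℚᵘ-homo‿- ((+ e) / N)) (ℚᵘₚ.-‿cong (ℚₚ.toℚᵘ-fromℚᵘ (mkℚᵘ (+ e) M)))))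

difference-term : ∀ K d → d ≤ K → ((+ K) ℤ.- (+ d)) / 1 ≡ (+ (K ∸ d)) / 1
difference-term K d d≤K = cong (_/ 1) (trans (ℤₚ.m-n≡m⊖n K d) (ℤₚ.⊖-≥ d≤K))

≤⇒<+pos : ∀ {x c ε} → x ℚ.≤ c → 0ℚ ℚ.< ε → x ℚ.< c ℚ.+ ε
≤⇒<+pos {x} {c} {ε} x≤c ε>0 = ℚₚ.≤-<-trans x≤c (subst (ℚ._< c ℚ.+ ε) (ℚₚ.+-identityʳ c) (ℚₚ.+-monoʳ-< c ε>0))

≤-difference-term : ∀ {a b k d} → d ≤ k → a + d * suc b ≤ k * suc b → (+ a) / suc b ℚ.≤ ((+ k) ℤ.- (+ d)) / 1
≤-difference-term {a} {b} {k} {d} d≤k a+ds≤ks rewrite difference-term k d d≤k = /-mono-≤ {a} {k ∸ d} {b} {0} (begin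
  a * 1                  ≡⟨ ℕₚ.*-identityʳ a ⟩
  a                      ≤⟨ ℕₚ.m+n≤o⇒m≤o∸n a a+ds≤ks ⟩
  k * suc b ∸ d * suc b  ≡⟨ ℕₚ.*-distribʳ-∸ (suc b) k d ⟨
  (k ∸ d) * suc b ∎)
  where open ℕₚ.≤-Reasoning

difference-term-≤ : ∀ {a b k d} → d ≤ k → k * suc b ≤ d * suc b + a → ((+ k) ℤ.- (+ d)) / 1 ℚ.≤ (+ a) / suc b
difference-term-≤ {a} {b} {k} {d} d≤k ks≤ds+a rewrite difference-term k d d≤k = /-mono-≤ {k ∸ d} {a} {0} {b} (begin
  (k ∸ d) * suc b        ≡⟨ ℕₚ.*-distribʳ-∸ (suc b) k d ⟩
  k * suc b ∸ d * suc b  ≤⟨ ℕₚ.m≤n+o⇒m∸n≤o (k * suc b) (d * suc b) ks≤ds+a ⟩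
  a                      ≡⟨ ℕₚ.*-identityʳ a ⟨
  a * 1 ∎)
  where open ℕₚ.≤-Reasoning

≤-density-term : ∀ {a b k e M} → e ≤ suc M → a * suc M + k * e * suc b ≤ k * suc M * suc b →
                 (+ a) / suc b ℚ.≤ (+ k) / 1 ℚ.* (1ℚ ℚ.- (+ e) / suc M)
≤-density-term {a} {b} {k} {e} {M} e≤N aN+kes≤kNs rewrite density-term k e M e≤N = /-mono-≤ {a} {k * (suc M ∸ e)} {b} {M} (begin
  a * suc M                       ≤⟨ ℕₚ.m+n≤o⇒m≤o∸n (a * suc M) aN+kes≤kNs ⟩
  k * suc M * suc b ∸ k * e * suc b ≡⟨ ℕₚ.*-distribʳ-∸ (suc b) (k * suc M) (k * e) ⟨
  (k * suc M ∸ k * e) * suc b      ≡⟨ cong (_* suc b) (ℕₚ.*-distribˡ-∸ k (suc M) e) ⟨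
  k * (suc M ∸ e) * suc b ∎)
  where open ℕₚ.≤-Reasoning

walk⇒disc-bound : ∀ {k n d} q (L : Digraph n) {v} → 2 ≤ k → WalkFrom L q v → DiscIs (cycle k) L d →
                  d * suc q ≤ k + q
walk⇒disc-bound {k} q L 2≤k walk (_ , minimal) =
  ℕₚ.≤-trans (ℕₚ.*-monoˡ-≤ (suc q) (minimal added winding-valid winding)) added-length
  where open WindAround k 2≤k L q (walkVertex L walk) (walkVertex-arc L walk)

walk-free⇒sparse : ∀ {n} j (L : Digraph n) → (∀ v → ¬ WalkFrom L (suc j) v) →
                   2 * suc j * arcCount L + n * n ≤ suc j * (n * n)
walk-free⇒sparse j L noWalk =
  ranked-arcCount-bound L (depth L j) (λ u → s≤s (depth≤ L j u)) (depth-descends L j noWalk)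

cycle-disc-dichotomy : ∀ {k n d} j (L : Digraph n) → 2 ≤ k → DiscIs (cycle k) L d →
                       d * suc (suc j) ≤ k + suc j ⊎ 2 * suc j * arcCount L + n * n ≤ suc j * (n * n)
cycle-disc-dichotomy j L 2≤k disc with Finₚ.any? (walkFrom? L (suc j))
... | yes (_ , walk) = inj₁ (walk⇒disc-bound (suc j) L 2≤k walk disc)
... | no noWalk = inj₂ (walk-free⇒sparse j L (λ v walk → noWalk (v , walk)))

-- ⌈k/(q+1)⌉ is the least b with k ≤ (q + 1) b.
ceiling-minimal : ∀ {a b k} q → a * suc q ≤ k + q → k ≤ suc q * b → a ≤ b
ceiling-minimal {a} {b} {k} q a[1+q]≤k+q k≤[1+q]b = ℕₚ.≤-pred (ℕₚ.*-cancelʳ-< (suc q) a (suc b) (begin-strict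
  a * suc q          ≤⟨ a[1+q]≤k+q ⟩
  k + q              ≤⟨ ℕₚ.+-monoˡ-≤ q k≤[1+q]b ⟩
  suc q * b + q      <⟨ ℕₚ.+-monoʳ-< (suc q * b) (ℕₚ.n<1+n q) ⟩
  suc q * b + suc q  ≡⟨ regroup q b ⟩
  suc b * suc q ∎))
  where
  open ℕₚ.≤-Reasoning
  regroup : ∀ q b → suc q * b + suc q ≡ suc b * suc q
  regroup = solve-∀

transitiveTournament-disc : ∀ {k} q → 2 ≤ k → ∃[ d ] DiscIs (cycle k) (transitiveTournament (suc q)) d × k ≤ suc q * d × d * suc q ≤ k + q
transitiveTournament-disc {suc zero} q (s≤s ())
transitiveTournament-disc {k@(suc (suc _))} q 2≤k =
  length added , ((added , winding-valid , winding , refl) , minimal) , transitiveTournament-copy-cost added winding , added-length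
  where
  open WindAround k 2≤k (transitiveTournament (suc q)) q (ascent q) (transitiveTournament-walk q)
  minimal : ∀ F → ValidAddition (transitiveTournament (suc q)) F → ContainsCopy (cycle k) (transitiveTournament (suc q)) F → length added ≤ length F
  minimal F _ copy = ceiling-minimal q added-length (transitiveTournament-copy-cost F copy)

-- Density at most (q - 1)/(2q) makes the first term of f(C_k, L) at least k (q + 1)/(2q).
sparse⇒≤-density-term : ∀ {a b k e j M} → 2 * suc j * e + suc M ≤ suc j * suc M →
                        a * (2 * suc j) ≤ k * suc (suc j) * suc b →
                        (+ a) / suc b ℚ.≤ (+ k) / 1 ℚ.* (1ℚ ℚ.- (+ e) / suc M)
sparse⇒≤-density-term {a} {b} {k} {e} {j} {M} sparse a/s≤ = ≤-density-term {a} {b} {k} {e} {M} e≤N (ℕₚ.*-cancelˡ-≤ (2 * q) (begin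
  2 * q * (a * N + k * e * s)                  ≡⟨ split a k e q N s ⟩
  a * (2 * q) * N + k * s * (2 * q * e)         ≤⟨ ℕₚ.+-monoˡ-≤ (k * s * (2 * q * e)) (ℕₚ.*-monoˡ-≤ N a/s≤) ⟩
  k * suc q * s * N + k * s * (2 * q * e)       ≡⟨ gather k q N s e ⟩
  k * s * (q * N + (2 * q * e + N))             ≤⟨ ℕₚ.*-monoʳ-≤ (k * s) (ℕₚ.+-monoʳ-≤ (q * N) sparse) ⟩
  k * s * (q * N + q * N)                       ≡⟨ finish k q N s ⟩
  2 * q * (k * N * s) ∎))
  where
  open ℕₚ.≤-Reasoning
  q N s : ℕ
  q = suc j
  N = suc M
  s = suc b
  reassociate : ∀ q e → q * (2 * e) ≡ 2 * q * e
  reassociate = solve-∀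
  split : ∀ a k e q N s → 2 * q * (a * N + k * e * s) ≡ a * (2 * q) * N + k * s * (2 * q * e)
  split = solve-∀
  gather : ∀ k q N s e → k * suc q * s * N + k * s * (2 * q * e) ≡ k * s * (q * N + (2 * q * e + N))
  gather = solve-∀
  finish : ∀ k q N s → k * s * (q * N + q * N) ≡ 2 * q * (k * N * s)
  finish = solve-∀
  e≤N : e ≤ N
  e≤N = ℕₚ.<⇒≤ (ℕₚ.≤-<-trans (ℕₚ.m≤n*m e 2) (ℕₚ.*-cancelˡ-< q (2 * e) N (begin-strict
    q * (2 * e)       ≡⟨ reassociate q e ⟩
    2 * q * e         <⟨ ℕₚ.m<m+n (2 * q * e) (s≤s z≤n) ⟩
    2 * q * e + N     ≤⟨ sparse ⟩
    q * N ∎)))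

fval-cycle : ∀ k {m} (L : Digraph (suc m)) d →
             fval (cycle k) L d ≡ ((+ k) / 1 ℚ.* (1ℚ ℚ.- density (arcCount L) (suc m))) ⊔ (((+ k) ℤ.- (+ d)) / 1)
fval-cycle k {m} L d =
  cong (λ K → ((+ K) / 1 ℚ.* (1ℚ ℚ.- density (arcCount L) (suc m))) ⊔ (((+ K) ℤ.- (+ d)) / 1)) (arcCount-cycle k)

FIs-intro : ∀ {k} {H : Digraph k} {c} →
            (∀ n (L : Digraph n) → IsDigraph L → HasArc L → ∀ d → DiscIs H L d → c ℚ.≤ fval H L d) →
            (Σ ℕ λ n → Σ (Digraph n) λ L → Σ ℕ λ d → IsDigraph L × HasArc L × DiscIs H L d × fval H L d ℚ.≤ c) →
            FIs H c
FIs-intro lower (n , L , d , isDigraph , hasArc , disc , fval≤c) =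
  lower , λ ε ε>0 → n , L , d , isDigraph , hasArc , disc , ≤⇒<+pos fval≤c ε>0

-- The dichotomy for walks with j + 1 arcs; each hypothesis bounds one term of f(C_k, L) from below.
cycle-lower-bound : ∀ {k a b} j → 2 ≤ k →
                    (∀ {d} → d * suc (suc j) ≤ k + suc j → d ≤ k × a + d * suc b ≤ k * suc b) →
                    a * (2 * suc j) ≤ k * suc (suc j) * suc b →
                    ∀ n (L : Digraph n) → IsDigraph L → HasArc L → ∀ d → DiscIs (cycle k) L d →
                    (+ a) / suc b ℚ.≤ fval (cycle k) L d
cycle-lower-bound j 2≤k short⇒ a/s≤ zero L _ (() , _) d disc
cycle-lower-bound {k} {a} {b} j 2≤k short⇒ a/s≤ (suc m) L _ _ d disc =
  subst ((+ a) / suc b ℚ.≤_) (sym (fval-cycle k L d)) (bound (cycle-disc-dichotomy j L 2≤k disc))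
  where
  bound : d * suc (suc j) ≤ k + suc j ⊎ 2 * suc j * arcCount L + suc m * suc m ≤ suc j * (suc m * suc m) →
          (+ a) / suc b ℚ.≤ ((+ k) / 1 ℚ.* (1ℚ ℚ.- density (arcCount L) (suc m))) ⊔ (((+ k) ℤ.- (+ d)) / 1)
  bound (inj₁ short) =
    let d≤k , a+ds≤ks = short⇒ {d} short in
    ℚₚ.p≤q⇒p≤r⊔q ((+ k) / 1 ℚ.* (1ℚ ℚ.- density (arcCount L) (suc m))) (≤-difference-term {a} {b} {k} {d} d≤k a+ds≤ks)
  bound (inj₂ sparse) = ℚₚ.p≤q⇒p≤q⊔r (((+ k) ℤ.- (+ d)) / 1) (sparse⇒≤-density-term {a} {b} {k} sparse a/s≤)

ceiling≤dividend : ∀ {d k} q → 1 ≤ k → d * suc q ≤ k + q → d ≤ k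
ceiling≤dividend {d} {k@(suc _)} q _ d[1+q]≤k+q = ℕₚ.*-cancelʳ-≤ d k (suc q) (begin
  d * suc q   ≤⟨ d[1+q]≤k+q ⟩
  k + q       ≤⟨ ℕₚ.+-monoʳ-≤ k (ℕₚ.m≤n*m q k) ⟩
  k + k * q   ≡⟨ ℕₚ.*-suc k q ⟨
  k * suc q ∎)
  where open ℕₚ.≤-Reasoning

-- ⌈k/4⌉ ≤ k/3 fails only for k = 5.
short-walk⇒3d≤k : ∀ {k d} → 3 ≤ k → k ≢ 5 → d * 4 ≤ k + 3 → d * 3 ≤ k
short-walk⇒3d≤k {d = 0} _ _ _ = z≤n
short-walk⇒3d≤k {d = 1} 3≤k _ _ = 3≤k
short-walk⇒3d≤k {k} {d = 2} _ k≢5 8≤k+3 with ℕₚ.m≤n⇒m<n∨m≡n (ℕₚ.+-cancelʳ-≤ 3 5 k 8≤k+3)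
... | inj₁ 5<k = 5<k
... | inj₂ 5≡k = ⊥-elim (k≢5 (sym 5≡k))
short-walk⇒3d≤k {k} {d@(suc (suc (suc _)))} _ _ d*4≤k+3 = ℕₚ.+-cancelʳ-≤ 3 (d * 3) k (begin
  d * 3 + 3   ≤⟨ ℕₚ.+-monoʳ-≤ (d * 3) (s≤s (s≤s (s≤s z≤n))) ⟩
  d * 3 + d   ≡⟨ regroup d ⟩
  d * 4       ≤⟨ d*4≤k+3 ⟩
  k + 3 ∎)
  where
  open ℕₚ.≤-Reasoning
  regroup : ∀ d → d * 3 + d ≡ d * 4
  regroup = solve-∀

short-walk-2k/3 : ∀ {k d} → 3 ≤ k → k ≢ 5 → d * 4 ≤ k + 3 → d ≤ k × 2 * k + d * 3 ≤ k * 3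
short-walk-2k/3 {k} {d} 3≤k k≢5 short = ℕₚ.≤-trans (ℕₚ.m≤m*n d 3) 3d≤k , (begin
  2 * k + d * 3  ≤⟨ ℕₚ.+-monoʳ-≤ (2 * k) 3d≤k ⟩
  2 * k + k      ≡⟨ regroup k ⟩
  k * 3 ∎)
  where
  open ℕₚ.≤-Reasoning
  3d≤k : d * 3 ≤ k
  3d≤k = short-walk⇒3d≤k {k} {d} 3≤k k≢5 short
  regroup : ∀ k → 2 * k + k ≡ k * 3
  regroup = solve-∀

short-walk-25/8 : ∀ {d} → d * 5 ≤ 5 + 4 → d ≤ 5 × 25 + d * 8 ≤ 5 * 8
short-walk-25/8 {0} _ = z≤n , ℕₚ.≤ᵇ⇒≤ 25 40 tt
short-walk-25/8 {1} _ = s≤s z≤n , ℕₚ.≤ᵇ⇒≤ 33 40 tt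
short-walk-25/8 {suc (suc d)} 10+5d≤9 = ⊥-elim (ℕₚ.<-irrefl refl (ℕₚ.m+n≤o⇒m≤o 10 10+5d≤9))

cycle-upper-2k/3 : ∀ {k} → 3 ≤ k → Σ ℕ λ n → Σ (Digraph n) λ L → Σ ℕ λ d →
                   IsDigraph L × HasArc L × DiscIs (cycle k) L d × fval (cycle k) L d ℚ.≤ (+ (2 * k)) / 3
cycle-upper-2k/3 {k} 3≤k with d , disc , k≤3d , d*3≤k+2 ← transitiveTournament-disc 2 (ℕₚ.≤-trans (ℕₚ.n≤1+n 2) 3≤k) =
  3 , transitiveTournament 3 , d , transitiveTournament-isDigraph 3 , (fzero , fsuc fzero , refl) , disc ,
  subst (ℚ._≤ (+ (2 * k)) / 3) (sym (fval-cycle k (transitiveTournament 3) d)) (ℚₚ.⊔-lub density≤ difference≤)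
  where
  density≤ : (+ k) / 1 ℚ.* (1ℚ ℚ.- (+ 3) / 9) ℚ.≤ (+ (2 * k)) / 3
  density≤ rewrite density-term k 3 8 (ℕₚ.≤ᵇ⇒≤ 3 9 tt) = /-mono-≤ {k * 6} {2 * k} {8} {2} (ℕₚ.≤-reflexive (regroup k))
    where regroup : ∀ k → k * 6 * 3 ≡ 2 * k * 9
          regroup = solve-∀
  difference≤ : ((+ k) ℤ.- (+ d)) / 1 ℚ.≤ (+ (2 * k)) / 3
  difference≤ = difference-term-≤ {2 * k} {2} {k} {d} (ceiling≤dividend 2 (ℕₚ.≤-trans (s≤s z≤n) 3≤k) d*3≤k+2) (begin
    k * 3          ≡⟨ regroup k ⟩
    k + 2 * k      ≤⟨ ℕₚ.+-monoˡ-≤ (2 * k) (subst (k ≤_) (ℕₚ.*-comm 3 d) k≤3d) ⟩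
    d * 3 + 2 * k ∎)
    where
    open ℕₚ.≤-Reasoning
    regroup : ∀ k → k * 3 ≡ k + 2 * k
    regroup = solve-∀

fval-C₅-T₄ : fval (cycle 5) (transitiveTournament 4) 2 ≡ (+ 25) / 8
fval-C₅-T₄ = refl

cycle-upper-25/8 : Σ ℕ λ n → Σ (Digraph n) λ L → Σ ℕ λ d →
                   IsDigraph L × HasArc L × DiscIs (cycle 5) L d × fval (cycle 5) L d ℚ.≤ (+ 25) / 8
cycle-upper-25/8 =
  let d , disc , 5≤4d , d*4≤8 = transitiveTournament-disc {5} 3 (s≤s (s≤s z≤n)) in
  4 , transitiveTournament 4 , d , transitiveTournament-isDigraph 4 , (fzero , fsuc fzero , refl) , disc ,
  subst (λ d → fval (cycle 5) (transitiveTournament 4) d ℚ.≤ (+ 25) / 8) (sym (exactly-two {d} 5≤4d d*4≤8))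
        (ℚₚ.≤-reflexive fval-C₅-T₄)
  where
  exactly-two : ∀ {d} → 5 ≤ 4 * d → d * 4 ≤ 5 + 3 → d ≡ 2
  exactly-two {2} _ _ = refl
  exactly-two {0} () _
  exactly-two {1} (s≤s (s≤s (s≤s (s≤s ())))) _
  exactly-two {suc (suc (suc d))} _ 12+4d≤8 =
    ⊥-elim (ℕₚ.<-irrefl refl (ℕₚ.≤-trans (ℕₚ.≤ᵇ⇒≤ 9 12 tt) (ℕₚ.m+n≤o⇒m≤o 12 {d * 4} 12+4d≤8)))

proposition3p3 : ((k : ℕ) → 3 ≤ k → k ≢ 5 → FIs (cycle k) ((+ (2 * k)) / 3))
                 × FIs (cycle 5) ((+ 25) / 8)
proposition3p3 =
    (λ k 3≤k k≢5 → FIs-intro (cycle-lower-bound 2 (ℕₚ.≤-trans (ℕₚ.n≤1+n 2) 3≤k) (short-walk-2k/3 3≤k k≢5)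
                                                  (ℕₚ.≤-reflexive (regroup k)))
                             (cycle-upper-2k/3 3≤k))
  , FIs-intro (cycle-lower-bound 3 (s≤s (s≤s z≤n)) short-walk-25/8 ℕₚ.≤-refl) cycle-upper-25/8
  where
  regroup : ∀ k → 2 * k * (2 * 3) ≡ k * 4 * 3
  regroup = solve-∀
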